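{- Let $w\in\widetilde{S}_n$ be not the identity, and suppose $w$ avoids the patterns $4231$ and $3412$. Let $\alpha$, $v$ and $u=u_1\cdots u_\ell$ be as described in the context. If $v$ is not decreasing, then $u=w_\alpha,\,w_\alpha-1,\,\dots,\,w_\alpha-m$ for some integer $m\ge 0$.
   Context: $\widetilde{S}_n$ is the set of bijections $w:\mathbb{Z}\to\mathbb{Z}$ with $w(i+n)=w(i)+n$ and $\sum_{i=1}^n w(i)=\binom{n+1}{2}$; write $w_i=w(i)$. Pattern containment: $w$ contains $p\in S_k$ if there exist integers $i_1<\dots<i_k$ with $w_{i_1},\dots,w_{i_k}$ in the same relative order as $p$. For $\gamma\in\mathbb{Z}$, the subword of $\gamma$-inversions of $w$ is $w_{\gamma}w_{j_1}\cdots w_{j_t}$, where $j_1<\dots<j_t$ are all indices $j>\gamma$ with $w_j<w_\gamma$; it is nontrivial if $t\ge1$. Let $\alpha\in\{1,\dots,n\}$ be the index such that $w_\alpha$ is the largest value among $w_1,\dots,w_n$ whose subword of $\alpha$-inversions is nontrivial, and let $v=w_\alpha w_{i_1}\cdots w_{i_p}$ be the subword of $\alpha$-inversions. Let $u=u_1\cdots u_\ell$ be the subsequence of right-to-left maxima of $v$ (read $v$ from right to left and record each value exceeding all values previously read; then write these in their original left-to-right order), so $u_1=w_\alpha$ and $u_\ell=w_{i_p}$. -}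

module Defs where

open import Data.Nat using (ℕ; zero; suc) renaming (_<_ to _<ℕ_)
open import Data.Nat.Combinatorics using (_C_)
open import Data.Integer using (ℤ; +_; _+_; _-_; _<_; _≤_)
open import Data.Fin using (Fin; toℕ) renaming (_<_ to _<F_)
open import Data.Vec using (Vec; lookup; _∷_; [])
open import Data.Product using (Σ; _×_; _,_; ∃)
open import Function.Definitions using (Bijective)
open import Relation.Binary.PropositionalEquality using (_≡_)
open import Data.Sum using (_⊎_)
open import Relation.Nullary using (¬_)

sumTo : (ℤ → ℤ) → ℕ → ℤ
sumTo f zero    = + 0
sumTo f (suc k) = sumTo f k + f (+ suc k)

record IsAffinePerm (n : ℕ) (w : ℤ → ℤ) : Set where
  field
    bijective : Bijective _≡_ _≡_ w
    periodic  : ∀ i → w (i + + n) ≡ w i + + n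
    sumCond   : sumTo w n ≡ + ((suc n) C 2)

Contains : (ℤ → ℤ) → {k : ℕ} → Vec ℕ k → Set
Contains w {k} p =
  Σ (Fin k → ℤ) λ i →
    (∀ a b → a <F b → i a < i b) ×
    (∀ a b → (w (i a) < w (i b) → lookup p a <ℕ lookup p b)
           × (lookup p a <ℕ lookup p b → w (i a) < w (i b)))

Avoids : (ℤ → ℤ) → {k : ℕ} → Vec ℕ k → Set
Avoids w p = ¬ Contains w p

p4231 : Vec ℕ 4
p4231 = 4 ∷ 2 ∷ 3 ∷ 1 ∷ []

p3412 : Vec ℕ 4
p3412 = 3 ∷ 4 ∷ 1 ∷ 2 ∷ []

-- j is an index of the subword of γ-inversions of w:
-- j = γ, or j > γ with w_j < w_γ
InInvSubword : (ℤ → ℤ) → ℤ → ℤ → Set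
InInvSubword w γ j = (j ≡ γ) ⊎ (γ < j × w j < w γ)

Nontrivial : (ℤ → ℤ) → ℤ → Set
Nontrivial w γ = ∃ λ j → γ < j × w j < w γ

IsAlpha : ℕ → (ℤ → ℤ) → ℤ → Set
IsAlpha n w α =
  (+ 1 ≤ α × α ≤ + n) × Nontrivial w α ×
  (∀ β → + 1 ≤ β → β ≤ + n → Nontrivial w β → w β ≤ w α)

Decreasing : (ℤ → ℤ) → ℤ → Set
Decreasing w α = ∀ j k → InInvSubword w α j → InInvSubword w α k →
                 j < k → w k < w j

IsRLMax : (ℤ → ℤ) → ℤ → ℤ → Set
IsRLMax w α j = InInvSubword w α j ×
  (∀ k → InInvSubword w α k → j < k → w k < w j)

-- the sequence u of right-to-left maxima of v (in left-to-right order)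
-- equals w_α, w_α - 1, ..., w_α - m : there is a strictly increasing
-- enumeration f_0 < ... < f_m of exactly the right-to-left-maximum positions,
-- with w(f_t) = w_α - t.
RLMaxesConsecutive : (ℤ → ℤ) → ℤ → ℕ → Set
RLMaxesConsecutive w α m =
  Σ (Fin (suc m) → ℤ) λ f →
    (∀ a b → a <F b → f a < f b) ×
    (∀ a → IsRLMax w α (f a)) ×
    (∀ j → IsRLMax w α j → ∃ λ a → f a ≡ j) ×
    (∀ a → w (f a) ≡ w α - + toℕ a)

-- Since w is periodic, α has only finitely many inversions; let z be the last one, so that v
-- ends with w_z and every right-to-left maximum of v has its value in [w_z, w_α]. Conversely,
-- take k with w_z < w_k < w_α. If k > α, a later inversion above w_k would form a 4231 with
-- α, k and z; if k < α, any ascent of v would form a 3412 (with k and α) or a 4231 (with α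
-- and z), so v would be decreasing. Since w is a bijection, u therefore consists of all the
-- integers from w_α down to w_z.
module Submission where

open import Defs
open import Data.Nat using (ℕ; _≤_)
open import Data.Integer using (ℤ)
open import Data.Product using (∃)
open import Relation.Binary.PropositionalEquality using (_≡_)
open import Relation.Nullary using (¬_)

open import Data.Nat as ℕ using (zero; suc; z≤n; s≤s; z<s; s<s; _<_; NonZero; >-nonZero)
import Data.Nat.Properties as NP
open import Data.Nat.DivMod using (_/_; _%_; m≡m%n+[m/n]*n; m%n<n)
open import Data.Integer
  using (+_; -[1+_]; _+_; _-_; ∣_∣; _⊓_; +<+; +≤+) renaming (_<_ to _<ℤ_; _≤_ to _≤ℤ_)
import Data.Integer.Properties as ZP
open import Data.Integer.Tactic.RingSolver using (solve-∀)
open import Data.Fin using (Fin; zero; suc; toℕ; fromℕ<; inject₁; #_) renaming (_<_ to _<F_)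
import Data.Fin.Properties as FP
open import Data.Vec using (Vec; lookup; _∷_; [])
open import Data.Product using (_×_; _,_; proj₁; proj₂; uncurry)
open import Data.Sum using (_⊎_; inj₁; inj₂)
open import Data.Empty using (⊥; ⊥-elim)
open import Function using (_∘_)
open import Function.Definitions using (Injective; Bijective)
open import Relation.Binary.PropositionalEquality
  using (_≢_; refl; sym; trans; cong; subst; subst₂; module ≡-Reasoning)
open import Relation.Binary.Definitions using (tri<; tri≈; tri>)
open import Relation.Nullary using (Dec; yes; no)
open import Relation.Nullary.Decidable using (from-yes; _×-dec_; _→-dec_)
open import Relation.Unary using (Decidable)

consecutive<⇒< : ∀ {k} (s : Fin (suc k) → ℤ) → (∀ a → s (inject₁ a) <ℤ s (suc a)) →
                 ∀ {a b} → a <F b → s a <ℤ s b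
consecutive<⇒< s step {zero} {suc zero} _ = step zero
consecutive<⇒< s step {zero} {suc (suc b)} _ =
  ZP.<-trans (step zero) (consecutive<⇒< (s ∘ suc) (step ∘ suc) {zero} {suc b} z<s)
consecutive<⇒< {suc k} s step {suc a} {suc b} (s<s a<b) = consecutive<⇒< (s ∘ suc) (step ∘ suc) a<b

<-reflected : ∀ {k} {s : Fin k → ℤ} → (∀ {a b} → a <F b → s a <ℤ s b) →
              ∀ {a b} → s a <ℤ s b → a <F b
<-reflected mono {a} {b} sa<sb with FP.<-cmp a b
... | tri< a<b _ _ = a<b
... | tri≈ _ refl _ = ⊥-elim (ZP.<-irrefl refl sa<sb)
... | tri> _ _ b<a = ⊥-elim (ZP.<-asym sa<sb (mono b<a))

IsRanking : ∀ {k} → Vec ℕ k → (Fin k → Fin k) → Set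
IsRanking p rank = ∀ a b → (lookup p a < lookup p b → rank a <F rank b)
                         × (rank a <F rank b → lookup p a < lookup p b)

isRanking? : ∀ {k} (p : Vec ℕ k) (rank : Fin k → Fin k) → Dec (IsRanking p rank)
isRanking? p rank = FP.all? λ a → FP.all? λ b →
  ((lookup p a ℕ.<? lookup p b) →-dec (rank a FP.<? rank b)) ×-dec
  ((rank a FP.<? rank b) →-dec (lookup p a ℕ.<? lookup p b))

-- pos lists the occurrence from left to right, pos ∘ unrank lists it by increasing value.
contains-via-ranking : ∀ {k} {w : ℤ → ℤ} (p : Vec ℕ (suc k)) {rank unrank : Fin (suc k) → Fin (suc k)} →
  IsRanking p rank → (∀ a → unrank (rank a) ≡ a) → (pos : Fin (suc k) → ℤ) →
  (∀ a → pos (inject₁ a) <ℤ pos (suc a)) →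
  (∀ r → w (pos (unrank (inject₁ r))) <ℤ w (pos (unrank (suc r)))) →
  Contains w p
contains-via-ranking {k} {w} p {rank} {unrank} ranking unrank∘rank pos pos-steps value-steps =
  pos , (λ _ _ → consecutive<⇒< pos pos-steps) , λ a b →
    (λ lt → proj₂ (ranking a b) (<-reflected value-mono (subst₂ _<ℤ_ (by-rank a) (by-rank b) lt))) ,
    (λ lt → subst₂ _<ℤ_ (sym (by-rank a)) (sym (by-rank b)) (value-mono (proj₁ (ranking a b) lt)))
  where
  value : Fin (suc k) → ℤ
  value r = w (pos (unrank r))

  value-mono : ∀ {r s} → r <F s → value r <ℤ value s
  value-mono = consecutive<⇒< value value-steps

  by-rank : ∀ a → w (pos a) ≡ value (rank a)
  by-rank a = cong (w ∘ pos) (sym (unrank∘rank a))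

rank4231 rank3412 : Fin 4 → Fin 4
rank4231 = lookup (# 3 ∷ # 1 ∷ # 2 ∷ # 0 ∷ [])
rank3412 = lookup (# 2 ∷ # 3 ∷ # 0 ∷ # 1 ∷ [])

ranking4231 : IsRanking p4231 rank4231
ranking4231 = from-yes (isRanking? p4231 rank4231)

ranking3412 : IsRanking p3412 rank3412
ranking3412 = from-yes (isRanking? p3412 rank3412)

-- Both patterns are involutions, so each ranking is its own inverse.
rank4231-involutive : ∀ a → rank4231 (rank4231 a) ≡ a
rank4231-involutive = from-yes (FP.all? λ a → rank4231 (rank4231 a) FP.≟ a)

rank3412-involutive : ∀ a → rank3412 (rank3412 a) ≡ a
rank3412-involutive = from-yes (FP.all? λ a → rank3412 (rank3412 a) FP.≟ a)

no-4231 : ∀ {w} → Avoids w p4231 → ∀ {a b c d} → a <ℤ b → b <ℤ c → c <ℤ d →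
          w d <ℤ w b → w b <ℤ w c → w c <ℤ w a → ⊥
no-4231 {w} avoids {a} {b} {c} {d} a<b b<c c<d d<bᵥ b<cᵥ c<aᵥ =
  avoids (contains-via-ranking {w = w} p4231 {rank4231} {rank4231} ranking4231 rank4231-involutive
           (lookup (a ∷ b ∷ c ∷ d ∷ []))
           (λ { zero → a<b ; (suc zero) → b<c ; (suc (suc zero)) → c<d })
           (λ { zero → d<bᵥ ; (suc zero) → b<cᵥ ; (suc (suc zero)) → c<aᵥ }))

no-3412 : ∀ {w} → Avoids w p3412 → ∀ {a b c d} → a <ℤ b → b <ℤ c → c <ℤ d →
          w c <ℤ w d → w d <ℤ w a → w a <ℤ w b → ⊥
no-3412 {w} avoids {a} {b} {c} {d} a<b b<c c<d c<dᵥ d<aᵥ a<bᵥ =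
  avoids (contains-via-ranking {w = w} p3412 {rank3412} {rank3412} ranking3412 rank3412-involutive
           (lookup (a ∷ b ∷ c ∷ d ∷ []))
           (λ { zero → a<b ; (suc zero) → b<c ; (suc (suc zero)) → c<d })
           (λ { zero → c<dᵥ ; (suc zero) → d<aᵥ ; (suc (suc zero)) → a<bᵥ }))

i+[j-i]≡j : ∀ i j → i + (j - i) ≡ j
i+[j-i]≡j = solve-∀

i-[i-j]≡j : ∀ i j → i - (i - j) ≡ j
i-[i-j]≡j = solve-∀

+∣j-i∣≡j-i : ∀ {i j} → i ≤ℤ j → + ∣ j - i ∣ ≡ j - i
+∣j-i∣≡j-i i≤j = ZP.0≤i⇒+∣i∣≡i (ZP.i≤j⇒0≤j-i i≤j)

+m<i⇒m<∣i∣ : ∀ {m i} → + m <ℤ i → m < ∣ i ∣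
+m<i⇒m<∣i∣ {i = + _} m<i = ZP.drop‿+<+ m<i
+m<i⇒m<∣i∣ {i = -[1+ _ ]} ()

Periodic : ℕ → (ℤ → ℤ) → Set
Periodic n w = ∀ i → w (i + + n) ≡ w i + + n

periodic-shift : ∀ {n} {w : ℤ → ℤ} → Periodic n w →
                 ∀ q i → w (i + + (q ℕ.* n)) ≡ w i + + (q ℕ.* n)
periodic-shift {w = w} periodic zero i = trans (cong w (ZP.+-identityʳ i)) (sym (ZP.+-identityʳ (w i)))
periodic-shift {n} {w} periodic (suc q) i = begin
  w (i + + (n ℕ.+ q ℕ.* n))   ≡⟨ cong w (split i) ⟩
  w ((i + + (q ℕ.* n)) + + n) ≡⟨ periodic (i + + (q ℕ.* n)) ⟩
  w (i + + (q ℕ.* n)) + + n   ≡⟨ cong (_+ + n) (periodic-shift {n} {w} periodic q i) ⟩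
  (w i + + (q ℕ.* n)) + + n   ≡⟨ split (w i) ⟨
  w i + + (n ℕ.+ q ℕ.* n)     ∎
  where
  open ≡-Reasoning
  swap : ∀ x a b → x + (a + b) ≡ (x + b) + a
  swap = solve-∀
  split : ∀ x → x + + (n ℕ.+ q ℕ.* n) ≡ (x + + (q ℕ.* n)) + + n
  split x = trans (cong (λ y → x + y) (ZP.pos-+ n (q ℕ.* n))) (swap x (+ n) (+ (q ℕ.* n)))

lower-bound-on-range : (g : ℕ → ℤ) (d : ℕ) → ∃ λ B → ∀ r → r < d → B ≤ℤ g r
lower-bound-on-range g zero = + 0 , λ _ ()
lower-bound-on-range g (suc d) with lower-bound-on-range g d
... | B , B≤g = B ⊓ g d , bound
  where
  bound : ∀ r → r < suc d → B ⊓ g d ≤ℤ g r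
  bound r r<1+d with NP.m<1+n⇒m<n∨m≡n r<1+d
  ... | inj₁ r<d = ZP.≤-trans (ZP.i⊓j≤i B (g d)) (B≤g r r<d)
  ... | inj₂ refl = ZP.i⊓j≤j B (g d)

periodic⇒linear-growth : ∀ {n} .{{_ : NonZero n}} {w : ℤ → ℤ} → Periodic n w →
                         ∀ α → ∃ λ C → ∀ t → + t <ℤ w (α + + t) + C
periodic⇒linear-growth {n} {w} periodic α with lower-bound-on-range (λ r → w (α + + r)) n
... | B , B≤w = C , growth
  where
  C : ℤ
  C = + n - B

  growth : ∀ t → + t <ℤ w (α + + t) + C
  growth t = begin-strict
    + t                                ≡⟨ split ⟩
    + r + + (q ℕ.* n)                  <⟨ ZP.+-monoˡ-< (+ (q ℕ.* n)) (+<+ (m%n<n t n)) ⟩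
    + n + + (q ℕ.* n)                  ≡⟨ cong (_+ + (q ℕ.* n)) (i+[j-i]≡j B (+ n)) ⟨
    (B + C) + + (q ℕ.* n)              ≤⟨ ZP.+-monoˡ-≤ (+ (q ℕ.* n)) (ZP.+-monoˡ-≤ C (B≤w r (m%n<n t n))) ⟩
    (w (α + + r) + C) + + (q ℕ.* n)    ≡⟨ swap (w (α + + r)) C (+ (q ℕ.* n)) ⟩
    (w (α + + r) + + (q ℕ.* n)) + C    ≡⟨ cong (_+ C) (periodic-shift {w = w} periodic q (α + + r)) ⟨
    w (α + + r + + (q ℕ.* n)) + C      ≡⟨ cong (λ i → w i + C) α+r+qn≡α+t ⟩
    w (α + + t) + C                    ∎
    where
    open ZP.≤-Reasoning
    r q : ℕ
    r = t % n
    q = t / n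
    split : + t ≡ + r + + (q ℕ.* n)
    split = trans (cong +_ (m≡m%n+[m/n]*n t n)) (ZP.pos-+ r (q ℕ.* n))
    α+r+qn≡α+t : α + + r + + (q ℕ.* n) ≡ α + + t
    α+r+qn≡α+t = trans (ZP.+-assoc α (+ r) _) (cong (λ y → α + y) (sym split))
    swap : ∀ x a b → (x + a) + b ≡ (x + b) + a
    swap = solve-∀

inversion-offsets-bounded : ∀ {n} .{{_ : NonZero n}} {w : ℤ → ℤ} → Periodic n w →
                            ∀ α → ∃ λ N → ∀ t → w (α + + t) <ℤ w α → t < N
inversion-offsets-bounded {w = w} periodic α with periodic⇒linear-growth {w = w} periodic α
... | C , grows = ∣ w α + C ∣ , λ t lt → +m<i⇒m<∣i∣ (ZP.<-trans (grows t) (ZP.+-monoˡ-< C lt))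

greatest-satisfying : ∀ {p} {P : ℕ → Set p} → Decidable P → ∀ {x} → P x → ∀ u → (∀ t → P t → t ≤ u) →
                      ∃ λ z → P z × (∀ t → P t → t ≤ z)
greatest-satisfying P? {x} Px zero bounded = x , Px , λ t Pt → NP.≤-trans (bounded t Pt) z≤n
greatest-satisfying P? Px (suc u) bounded with P? (suc u)
... | yes Pu = suc u , Pu , bounded
... | no ¬Pu = greatest-satisfying P? Px u λ t Pt →
  NP.m<1+n⇒m≤n (NP.≤∧≢⇒< (bounded t Pt) λ { refl → ¬Pu Pt })

Inversion : (ℤ → ℤ) → ℤ → ℤ → Set
Inversion w α j = α <ℤ j × w j <ℤ w α

inversion? : ∀ w α → Decidable (Inversion w α)
inversion? w α j = (α ZP.<? j) ×-dec (w j ZP.<? w α)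

offset-form : ∀ {i j} → i ≤ℤ j → i + + ∣ j - i ∣ ≡ j
offset-form {i} {j} i≤j = trans (cong (λ y → i + y) (+∣j-i∣≡j-i i≤j)) (i+[j-i]≡j i j)

inversion-at-offset : ∀ {w α k} → Inversion w α k → Inversion w α (α + + ∣ k - α ∣)
inversion-at-offset {w} {α} k-inversion =
  subst (Inversion w α) (sym (offset-form (ZP.<⇒≤ (proj₁ k-inversion)))) k-inversion

last-inversion : ∀ {n} .{{_ : NonZero n}} {w : ℤ → ℤ} → Periodic n w →
                 ∀ {α} → Nontrivial w α → ∃ λ z → Inversion w α z × (∀ j → Inversion w α j → j ≤ℤ z)
last-inversion {w = w} periodic {α} (j , j-inversion) with inversion-offsets-bounded {w = w} periodic α
... | N , bounded
  with greatest-satisfying (λ t → inversion? w α (α + + t)) (inversion-at-offset j-inversion) N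
                          (λ t t-inversion → NP.<⇒≤ (bounded t (proj₂ t-inversion)))
... | t , t-inversion , t-greatest = α + + t , t-inversion , λ k k-inversion →
  subst (_≤ℤ α + + t) (offset-form (ZP.<⇒≤ (proj₁ k-inversion)))
        (ZP.+-monoʳ-≤ α (+≤+ (t-greatest _ (inversion-at-offset k-inversion))))

-- Hypothesis names ending in ᵥ compare values of w, the others compare positions.
module LastInversion {w : ℤ → ℤ} (injective : Injective _≡_ _≡_ w)
                     (avoids4231 : Avoids w p4231) (avoids3412 : Avoids w p3412)
                     {α z : ℤ} (z-inversion : Inversion w α z)
                     (z-last : ∀ j → Inversion w α j → j ≤ℤ z) where

  compare-values : ∀ {j k} → j ≢ k → w j <ℤ w k ⊎ w k <ℤ w j
  compare-values {j} {k} j≢k with ZP.<-cmp (w j) (w k)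
  ... | tri< lt _ _ = inj₁ lt
  ... | tri≈ _ eq _ = ⊥-elim (j≢k (injective eq))
  ... | tri> _ _ gt = inj₂ gt

  <⇒values≢ : ∀ {j k} → j <ℤ k → w j ≢ w k
  <⇒values≢ j<k eq = ZP.<⇒≢ j<k (injective eq)

  before-last : ∀ {k} → Inversion w α k → w z <ℤ w k → k <ℤ z
  before-last {k} k-inversion z<k = ZP.≤∧≢⇒< (z-last k k-inversion) λ { refl → ZP.<-irrefl refl z<k }

  subword⇒≤last : ∀ {j} → InInvSubword w α j → j ≤ℤ z
  subword⇒≤last (inj₁ refl) = ZP.<⇒≤ (proj₁ z-inversion)
  subword⇒≤last (inj₂ j-inversion) = z-last _ j-inversion

  right-of-α⇒rlMax : ∀ {k} → α <ℤ k → w z ≤ℤ w k → w k <ℤ w α → IsRLMax w α k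
  right-of-α⇒rlMax {k} α<k z≤k k<α = inj₂ (α<k , k<α) , later-smaller
    where
    later-smaller : ∀ k′ → InInvSubword w α k′ → k <ℤ k′ → w k′ <ℤ w k
    later-smaller k′ (inj₁ refl) k<k′ = ⊥-elim (ZP.<-asym α<k k<k′)
    later-smaller k′ (inj₂ k′-inversion) k<k′ with compare-values (ZP.<⇒≢ k<k′)
    ... | inj₂ k′<k = k′<k
    ... | inj₁ k<k′ᵥ = ⊥-elim (no-4231 avoids4231 α<k k<k′ (before-last k′-inversion z<k′) z<k k<k′ᵥ
                                        (proj₂ k′-inversion))
      where
      z<k : w z <ℤ w k
      z<k = ZP.≤∧≢⇒< z≤k (<⇒values≢ (ZP.<-≤-trans k<k′ (z-last k′ k′-inversion)) ∘ sym)
      z<k′ : w z <ℤ w k′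
      z<k′ = ZP.<-trans z<k k<k′ᵥ

  module _ {k} (k<α : k <ℤ α) (z<k : w z <ℤ w k) (k<αᵥ : w k <ℤ w α) where

    ascent-before-last : ∀ {j k′} → α <ℤ j → j <ℤ k′ → k′ <ℤ z → w j <ℤ w k′ → w k′ <ℤ w α → ⊥
    ascent-before-last α<j j<k′ k′<z j<k′ᵥ k′<α with compare-values (ZP.<⇒≢ (ZP.<-trans j<k′ k′<z))
    ... | inj₂ z<j = no-4231 avoids4231 α<j j<k′ k′<z z<j j<k′ᵥ k′<α
    ... | inj₁ j<z = no-3412 avoids3412 k<α α<j (ZP.<-trans j<k′ k′<z) j<z z<k k<αᵥ

    no-inversion-ascent : ∀ {j k′} → Inversion w α j → Inversion w α k′ → j <ℤ k′ → w j <ℤ w k′ → ⊥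
    no-inversion-ascent (α<j , _) k′-inversion@(α<k′ , k′<α) j<k′ j<k′ᵥ
      with compare-values (ZP.<⇒≢ (ZP.<-trans k<α α<k′))
    ... | inj₂ k′<k = no-3412 avoids3412 k<α α<j j<k′ j<k′ᵥ k′<k k<αᵥ
    ... | inj₁ k<k′ =
      ascent-before-last α<j j<k′ (before-last k′-inversion (ZP.<-trans z<k k<k′)) j<k′ᵥ k′<α

    left-of-α⇒decreasing : Decreasing w α
    left-of-α⇒decreasing j k′ j-in k′-in j<k′ with compare-values (ZP.<⇒≢ j<k′)
    ... | inj₂ k′<j = k′<j
    ... | inj₁ j<k′ᵥ = ⊥-elim (no-ascent j-in k′-in)
      where
      no-ascent : InInvSubword w α j → InInvSubword w α k′ → ⊥
      no-ascent (inj₁ refl) (inj₁ refl) = ZP.<-irrefl refl j<k′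
      no-ascent (inj₁ refl) (inj₂ (_ , k′<α)) = ZP.<-asym k′<α j<k′ᵥ
      no-ascent (inj₂ (α<j , _)) (inj₁ refl) = ZP.<-asym α<j j<k′
      no-ascent (inj₂ j-inversion) (inj₂ k′-inversion) =
        no-inversion-ascent j-inversion k′-inversion j<k′ j<k′ᵥ

  between⇒rlMax : ¬ Decreasing w α → ∀ {k} → w z ≤ℤ w k → w k ≤ℤ w α → IsRLMax w α k
  between⇒rlMax ¬decreasing {k} z≤k k≤α with ZP.<-cmp k α
  ... | tri≈ _ refl _ = inj₁ refl , λ where
    k′ (inj₁ refl) k<k′ → ⊥-elim (ZP.<-irrefl refl k<k′)
    k′ (inj₂ (_ , k′<α)) _ → k′<α
  ... | tri> _ _ α<k = right-of-α⇒rlMax α<k z≤k (ZP.≤∧≢⇒< k≤α (<⇒values≢ α<k ∘ sym))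
  ... | tri< k<α _ _ = ⊥-elim (¬decreasing (left-of-α⇒decreasing k<α z<k (ZP.≤∧≢⇒< k≤α (<⇒values≢ k<α))))
    where
    z<k : w z <ℤ w k
    z<k = ZP.≤∧≢⇒< z≤k (<⇒values≢ (ZP.<-trans k<α (proj₁ z-inversion)) ∘ sym)

  rlMax⇒between : ∀ {j} → IsRLMax w α j → w z ≤ℤ w j × w j ≤ℤ w α
  rlMax⇒between {j} (j-in , later-smaller) = above-last , below-α j-in
    where
    below-α : InInvSubword w α j → w j ≤ℤ w α
    below-α (inj₁ refl) = ZP.≤-refl
    below-α (inj₂ (_ , j<α)) = ZP.<⇒≤ j<α
    above-last : w z ≤ℤ w j
    above-last with ZP.<-cmp j z
    ... | tri< j<z _ _ = ZP.<⇒≤ (later-smaller z (inj₂ z-inversion) j<z)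
    ... | tri≈ _ refl _ = ZP.≤-refl
    ... | tri> _ _ z<j = ⊥-elim (ZP.<⇒≱ z<j (subword⇒≤last j-in))

interval⇒offset : ∀ {L c x} → L ≤ℤ x → x ≤ℤ c → ∃ λ t → t ≤ ∣ c - L ∣ × x ≡ c - + t
interval⇒offset {L} {c} {x} L≤x x≤c = ∣ c - x ∣ , ZP.drop‿+≤+ c-x≤c-L , x≡c-[c-x]
  where
  c-x≤c-L : + ∣ c - x ∣ ≤ℤ + ∣ c - L ∣
  c-x≤c-L = subst₂ _≤ℤ_ (sym (+∣j-i∣≡j-i x≤c)) (sym (+∣j-i∣≡j-i (ZP.≤-trans L≤x x≤c)))
                   (ZP.+-monoʳ-≤ c (ZP.neg-mono-≤ L≤x))
  x≡c-[c-x] : x ≡ c - + ∣ c - x ∣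
  x≡c-[c-x] = trans (sym (i-[i-j]≡j c x)) (cong (c -_) (sym (+∣j-i∣≡j-i x≤c)))

offset⇒interval : ∀ {L c t} → L ≤ℤ c → t ≤ ∣ c - L ∣ → L ≤ℤ c - + t × c - + t ≤ℤ c
offset⇒interval {L} {c} {t} L≤c t≤∣c-L∣ =
  subst (_≤ℤ c - + t) (i-[i-j]≡j c L) c-[c-L]≤c-t , ZP.i-j≤i c (+ t)
  where
  c-[c-L]≤c-t : c - (c - L) ≤ℤ c - + t
  c-[c-L]≤c-t = ZP.+-monoʳ-≤ c (ZP.neg-mono-≤ (subst (+ t ≤ℤ_) (+∣j-i∣≡j-i L≤c) (+≤+ t≤∣c-L∣)))

rlMaxes-consecutive : ∀ {w} → Bijective _≡_ _≡_ w → ∀ {α m} →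
  (∀ {j} → IsRLMax w α j → ∃ λ t → t ≤ m × w j ≡ w α - + t) →
  (∀ {j t} → t ≤ m → w j ≡ w α - + t → IsRLMax w α j) →
  RLMaxesConsecutive w α m
rlMaxes-consecutive {w} (injective , surjective) {α} {m} rlMax⇒offset offset⇒rlMax =
  f , f-increasing , f-rlMax , f-covers , w∘f
  where
  f : Fin (suc m) → ℤ
  f a = proj₁ (surjective (w α - + toℕ a))

  w∘f : ∀ a → w (f a) ≡ w α - + toℕ a
  w∘f a = proj₂ (surjective (w α - + toℕ a)) refl

  f-rlMax : ∀ a → IsRLMax w α (f a)
  f-rlMax a = offset⇒rlMax (NP.m<1+n⇒m≤n (FP.toℕ<n a)) (w∘f a)

  f-values-decrease : ∀ {a b} → a <F b → w (f b) <ℤ w (f a)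
  f-values-decrease {a} {b} a<b =
    subst₂ _<ℤ_ (sym (w∘f b)) (sym (w∘f a)) (ZP.+-monoʳ-< (w α) (ZP.neg-mono-< (+<+ a<b)))

  f-increasing : ∀ a b → a <F b → f a <ℤ f b
  f-increasing a b a<b with ZP.<-cmp (f a) (f b)
  ... | tri< fa<fb _ _ = fa<fb
  ... | tri≈ _ fa≡fb _ = ⊥-elim (ZP.<-irrefl (cong w (sym fa≡fb)) (f-values-decrease a<b))
  ... | tri> _ _ fb<fa =
    ⊥-elim (ZP.<-asym (f-values-decrease a<b) (proj₂ (f-rlMax b) (f a) (proj₁ (f-rlMax a)) fb<fa))

  f-covers : ∀ j → IsRLMax w α j → ∃ λ a → f a ≡ j
  f-covers j j-rlMax with rlMax⇒offset j-rlMax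
  ... | t , t≤m , wj≡ = a , injective (trans (w∘f a) (trans (cong (λ s → w α - + s) toℕa≡t) (sym wj≡)))
    where
    a : Fin (suc m)
    a = fromℕ< (s≤s t≤m)
    toℕa≡t : toℕ a ≡ t
    toℕa≡t = FP.toℕ-fromℕ< (s≤s t≤m)

lemma3p2 : (n : ℕ) → 1 ≤ n → (w : ℤ → ℤ) → IsAffinePerm n w →
    ¬ (∀ i → w i ≡ i) → Avoids w p4231 → Avoids w p3412 →
    (α : ℤ) → IsAlpha n w α → ¬ Decreasing w α →
    ∃ λ (m : ℕ) → RLMaxesConsecutive w α m
lemma3p2 n 1≤n w affine _ avoids4231 avoids3412 α (_ , nontrivial , _) ¬decreasing
  with last-inversion {{>-nonZero 1≤n}} {w = w} (IsAffinePerm.periodic affine) nontrivial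
... | z , z-inversion , z-last =
  ∣ w α - w z ∣ ,
  rlMaxes-consecutive bijective (uncurry interval⇒offset ∘ rlMax⇒between) λ t≤m wj≡ →
    uncurry (between⇒rlMax ¬decreasing)
      (subst (λ y → w z ≤ℤ y × y ≤ℤ w α) (sym wj≡) (offset⇒interval (ZP.<⇒≤ (proj₂ z-inversion)) t≤m))
  where
  open IsAffinePerm affine using (bijective)
  open LastInversion (proj₁ bijective) avoids4231 avoids3412 z-inversion z-last
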